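{- Let $s_y\ge0$ and $t\ge1$ be integers, $Y=[0,s_y]$, $a=4s_y+3$, and let $A=I_1\cup I_2\cup I_3\cup T\cup S$ where $I_1=[0,t]\times Y$, $T=[0,(t),at^2-t]\times\{0\}$, $S=[at^2,(t+1),(a+1)t^2-1]\times Y$, $I_2=[2at^2,2at^2+t]\times Y$, $I_3=[(3a+1)t^2,(3a+1)t^2+t]\times Y$. Then $|A|=(8s_y+7)t+(3s_y+1)$ and $A+A\supseteq[0,(16s_y+14)t^2-1]\times[0,s_y]$.
   Context: For integers $m\le n$, $[m,n]$ denotes $\{m,\dots,n\}$. For integers $a\le b$ and $t\ge1$ with $t\mid b-a$, $[a,(t),b]=\{a,a+t,a+2t,\dots,b\}$. For sets of integer points, $A+A=\{(x+x',y+y'):(x,y),(x',y')\in A\}$. -}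

module Defs where

open import Data.Nat using (ℕ; zero; suc; _+_; _*_; _∸_; _/_; NonZero)
open import Data.Nat.Properties using (_≟_)
open import Data.Product using (_×_; _,_; Σ; ∃)
open import Data.Product.Properties using (≡-dec)
open import Data.List using (List; []; _∷_; map; upTo; cartesianProduct; _++_; deduplicate; length)
open import Data.List.Membership.Propositional using (_∈_)
open import Relation.Binary.PropositionalEquality using (_≡_)
open import Relation.Binary.Definitions using (DecidableEquality)

[_,_] : ℕ → ℕ → List ℕ
[ m , n ] = map (m +_) (upTo (suc n ∸ m))

-- arithmetic progression [a,(t),b] = {a, a+t, …, b}; used only when t ∣ b − a and a ≤ b
AP : ℕ → (t : ℕ) → .{{NonZero t}} → ℕ → List ℕ
AP a t b = map (λ k → a + k * t) (upTo (suc ((b ∸ a) / t)))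

_×ˢ_ : List ℕ → List ℕ → List (ℕ × ℕ)
X ×ˢ Y = cartesianProduct X Y

_≟ₚ_ : DecidableEquality (ℕ × ℕ)
_≟ₚ_ = ≡-dec _≟_ _≟_

card : List (ℕ × ℕ) → ℕ
card L = length (deduplicate _≟ₚ_ L)

_∈_+ˢ_ : ℕ × ℕ → List (ℕ × ℕ) → List (ℕ × ℕ) → Set
(x , y) ∈ A +ˢ B = Σ (ℕ × ℕ) λ p → Σ (ℕ × ℕ) λ q →
  p ∈ A × q ∈ B × (Data.Product.proj₁ p + Data.Product.proj₁ q ≡ x) × (Data.Product.proj₂ p + Data.Product.proj₂ q ≡ y)

module Construction (sy t : ℕ) .{{_ : NonZero t}} where
  Y : List ℕ
  Y = [ 0 , sy ]
  a : ℕ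
  a = 4 * sy + 3
  I₁ I₂ I₃ T S A : List (ℕ × ℕ)
  I₁ = [ 0 , t ] ×ˢ Y
  T  = AP 0 t (a * t * t ∸ t) ×ˢ (0 ∷ [])
  S  = AP (a * t * t) (suc t) ((a + 1) * t * t ∸ 1) ×ˢ Y
  I₂ = [ 2 * a * t * t , 2 * a * t * t + t ] ×ˢ Y
  I₃ = [ (3 * a + 1) * t * t , (3 * a + 1) * t * t + t ] ×ˢ Y
  A  = I₁ ++ I₂ ++ I₃ ++ T ++ S

{-# OPTIONS --safe #-}
-- With a = 4 s_y + 3, the seven sumsets I₁+T, S+I₁, S+T, I₂+T, S+I₂, I₃+T, S+I₃ cover consecutive
-- x-ranges [0, at²), [at², at² + t²), [at² + t², 2at²), …, [(4a+1)t², (4a+2)t²) at every height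
-- y ≤ s_y. A column of width t (or t + 1) plus a progression of step t (or t + 1) covers an interval by
-- division with remainder; S+T covers the long middle range because t² + qt + r = r(t+1) + (t − r + q)t
-- for r < t. The blocks of A are pairwise disjoint except for (0, 0), (t, 0) ∈ I₁ ∩ T,
-- which accounts for the cardinality.
module Submission where

open import Defs
open import Data.Nat using (ℕ; suc; _+_; _*_; _∸_; _≤_; _<_)
open import Data.Product using (_×_; _,_)
open import Relation.Binary.PropositionalEquality using (_≡_)

open import Data.Nat using (z≤n; s≤s; NonZero; _/_; _%_; _<?_)
open import Data.Nat.Properties
open import Data.Nat.DivMod using (m≡m%n+[m/n]*n; m%n<n; m*n/n≡m; m<n*o⇒m/o<n)
open import Data.Nat.Tactic.RingSolver using (solve-∀)
open import Data.Product using (∃₂; proj₁; proj₂)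
open import Data.Sum using ([_,_]′)
open import Data.List using (List; []; _∷_; map; upTo; _++_; length; cartesianProduct)
open import Data.List.Properties using (length-map; length-upTo; length-++)
open import Data.List.Membership.Propositional using (_∈_)
open import Data.List.Membership.Propositional.Properties
  using (∈-map⁺; ∈-map⁻; ∈-++⁺ˡ; ∈-++⁺ʳ; ∈-++⁻; ∈-upTo⁺; ∈-upTo⁻; ∈-cartesianProduct⁺; ∈-cartesianProduct⁻; deduplicate-∈⇔)
open import Data.List.Membership.Propositional.Properties.WithK using (unique∧set⇒bag)
open import Data.List.Relation.Binary.BagAndSetEquality using (∼bag⇒↭)
open import Data.List.Relation.Binary.Permutation.Propositional.Properties using (↭-length)
open import Data.List.Relation.Binary.Subset.Propositional using (_⊆_)
open import Data.List.Relation.Unary.Any using (here)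
open import Data.List.Relation.Unary.All using ([])
open import Data.List.Relation.Unary.AllPairs using ([]; _∷_)
open import Data.List.Relation.Unary.Unique.Propositional using (Unique)
import Data.List.Relation.Unary.Unique.Propositional.Properties as Unique
import Data.List.Relation.Unary.Unique.DecPropositional.Properties as UniqueDec
open import Function.Base using (_∘_)
open import Function.Bundles using (mk⇔; Equivalence)
open import Relation.Binary.PropositionalEquality using (refl; sym; trans; cong; cong₂; subst; module ≡-Reasoning)
open import Relation.Nullary using (yes; no)

length-cartesianProduct : ∀ {A B : Set} (xs : List A) (ys : List B) →
  length (cartesianProduct xs ys) ≡ length xs * length ys
length-cartesianProduct []       ys = refl
length-cartesianProduct (x ∷ xs) ys = begin
  length (map (x ,_) ys ++ cartesianProduct xs ys)          ≡⟨ length-++ (map (x ,_) ys) ⟩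
  length (map (x ,_) ys) + length (cartesianProduct xs ys)  ≡⟨ cong (_+ _) (length-map (x ,_) ys) ⟩
  length ys + length (cartesianProduct xs ys)               ≡⟨ cong (length ys +_) (length-cartesianProduct xs ys) ⟩
  length ys + length xs * length ys                         ∎
  where open ≡-Reasoning

length-++-≡ : ∀ {A : Set} (xs ys : List A) {m n} → length xs ≡ m → length ys ≡ n → length (xs ++ ys) ≡ m + n
length-++-≡ xs ys refl refl = length-++ xs

++-⊆ : ∀ {A : Set} (xs : List A) {ys zs} → xs ⊆ zs → ys ⊆ zs → xs ++ ys ⊆ zs
++-⊆ xs xs⊆zs ys⊆zs z∈ = [ xs⊆zs , ys⊆zs ]′ (∈-++⁻ xs z∈)

card-≡-length : ∀ {L xs : List (ℕ × ℕ)} → Unique xs → L ⊆ xs → xs ⊆ L → card L ≡ length xs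
card-≡-length {L} xs! L⊆xs xs⊆L = ↭-length (∼bag⇒↭ (unique∧set⇒bag (UniqueDec.deduplicate-! _≟ₚ_ L) xs!
  (mk⇔ (L⊆xs ∘ Equivalence.from (deduplicate-∈⇔ _≟ₚ_)) (Equivalence.to (deduplicate-∈⇔ _≟ₚ_) ∘ xs⊆L))))

interval≡map : ∀ m n → [ m , m + n ] ≡ map (m +_) (upTo (suc n))
interval≡map m n = cong (map (m +_) ∘ upTo) (trans (cong (_∸ m) (sym (+-suc m n))) (m+n∸m≡n m (suc n)))

AP≡map : ∀ a t .{{_ : NonZero t}} n {b} → b ≡ a + n * t → AP a t b ≡ map (λ k → a + k * t) (upTo (suc n))
AP≡map a t n refl = cong (map (λ k → a + k * t) ∘ upTo ∘ suc) (trans (cong (_/ t) (m+n∸m≡n a (n * t))) (m*n/n≡m n t))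

m<n⇒m*[1+n]<n*n : ∀ {m n} → m < n → m * suc n < n * n
m<n⇒m*[1+n]<n*n {m} {suc n} (s≤s m≤n) = begin-strict
  m * suc (suc n)  ≤⟨ *-monoˡ-≤ (suc (suc n)) m≤n ⟩
  n * suc (suc n)  ≡⟨ *-suc n (suc n) ⟩
  n + n * suc n    <⟨ +-monoˡ-< (n * suc n) (n<1+n n) ⟩
  suc n * suc n    ∎
  where open ≤-Reasoning

-- Opaque, so that unification sees the block structure rather than partially evaluated lists.
opaque
  grid : (ℕ → ℕ) → ℕ → List ℕ → List (ℕ × ℕ)
  grid f n ys = map f (upTo n) ×ˢ ys

  grid-unfold : ∀ f n ys → grid f n ys ≡ map f (upTo n) ×ˢ ys
  grid-unfold f n ys = refl

  ∈-grid⁺ : ∀ f {n ys k y} → k < n → y ∈ ys → (f k , y) ∈ grid f n ys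
  ∈-grid⁺ f k<n y∈ys = ∈-cartesianProduct⁺ (∈-map⁺ f (∈-upTo⁺ k<n)) y∈ys

  ∈-grid⁻ : ∀ f {n ys z} → z ∈ grid f n ys → ∃₂ λ k y → k < n × y ∈ ys × z ≡ (f k , y)
  ∈-grid⁻ f {n} {ys} {x , y} z∈ with ∈-cartesianProduct⁻ (map f (upTo n)) ys z∈
  ... | x∈ , y∈ with ∈-map⁻ f x∈
  ...   | k , k∈ , refl = k , y , ∈-upTo⁻ k∈ , y∈ , refl

  length-grid : ∀ f n ys → length (grid f n ys) ≡ n * length ys
  length-grid f n ys = trans (length-cartesianProduct (map f (upTo n)) ys)
    (cong (_* length ys) (trans (length-map f (upTo n)) (length-upTo n)))

  unique-grid : ∀ {f} n {ys} → (∀ {i j} → f i ≡ f j → i ≡ j) → Unique ys → Unique (grid f n ys)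
  unique-grid n f-injective ys! = Unique.cartesianProduct⁺ (Unique.map⁺ f-injective (Unique.upTo⁺ n)) ys!

Within : ℕ → ℕ → List (ℕ × ℕ) → Set
Within l h xs = ∀ {z} → z ∈ xs → l ≤ proj₁ z × proj₁ z < h

within-grid : ∀ {f n ys l h} → (∀ {k} → k < n → l ≤ f k × f k < h) → Within l h (grid f n ys)
within-grid {f} bounds z∈ with ∈-grid⁻ f z∈
... | _ , _ , k<n , _ , refl = bounds k<n

UniqueAbove : ℕ → List (ℕ × ℕ) → Set
UniqueAbove l xs = Unique xs × (∀ {z} → z ∈ xs → l ≤ proj₁ z)

++-uniqueAbove : ∀ {l h xs ys} → l ≤ h → Unique xs → Within l h xs → UniqueAbove h ys → UniqueAbove l (xs ++ ys)
++-uniqueAbove {xs = xs} l≤h xs! xs-within (ys! , ys-above) =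
  Unique.++⁺ xs! ys! (λ (x∈ , y∈) → <⇒≱ (proj₂ (xs-within x∈)) (ys-above y∈)) ,
  λ z∈ → [ proj₁ ∘ xs-within , ≤-trans l≤h ∘ ys-above ]′ (∈-++⁻ xs z∈)

record Covers (P : ℕ → Set) (b n : ℕ) : Set where
  constructor covering
  field
    cover : ∀ m → m < n → P (b + m)

open Covers

covers-map : ∀ {P Q : ℕ → Set} {b n} → (∀ {x} → P x → Q x) → Covers P b n → Covers Q b n
covers-map P⇒Q cov = covering λ m m<n → P⇒Q (cover cov m m<n)

covers-≤ : ∀ {P b n n′} → n ≤ n′ → Covers P b n′ → Covers P b n
covers-≤ n≤n′ cov = covering λ m m<n → cover cov m (<-≤-trans m<n n≤n′)

covers-++ : ∀ {P b c n₁ n₂} → b + n₁ ≡ c → Covers P b n₁ → Covers P c n₂ → Covers P b (n₁ + n₂)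
covers-++ {P} {b} {c} {n₁} {n₂} b+n₁≡c cov₁ cov₂ = covering cover-++
  where
  cover-++ : ∀ m → m < n₁ + n₂ → P (b + m)
  cover-++ m m<n₁+n₂ with m <? n₁
  ... | yes m<n₁ = cover cov₁ m m<n₁
  ... | no m≮n₁ = subst P c+[m∸n₁]≡b+m (cover cov₂ (m ∸ n₁) m∸n₁<n₂)
    where
    n₁+[m∸n₁]≡m : n₁ + (m ∸ n₁) ≡ m
    n₁+[m∸n₁]≡m = m+[n∸m]≡n (≮⇒≥ m≮n₁)
    m∸n₁<n₂ : m ∸ n₁ < n₂
    m∸n₁<n₂ = +-cancelˡ-< n₁ (m ∸ n₁) n₂ (subst (_< n₁ + n₂) (sym n₁+[m∸n₁]≡m) m<n₁+n₂)
    c+[m∸n₁]≡b+m : c + (m ∸ n₁) ≡ b + m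
    c+[m∸n₁]≡b+m = begin
      c + (m ∸ n₁)         ≡⟨ cong (_+ (m ∸ n₁)) b+n₁≡c ⟨
      b + n₁ + (m ∸ n₁)    ≡⟨ +-assoc b n₁ (m ∸ n₁) ⟩
      b + (n₁ + (m ∸ n₁))  ≡⟨ cong (b +_) n₁+[m∸n₁]≡m ⟩
      b + m                ∎
      where open ≡-Reasoning

+-interchange : ∀ e b r s → e + s + (b + r) ≡ e + b + (r + s)
+-interchange = solve-∀

staircase-identity : ∀ e r s q → e + r * suc (r + s) + (s + q) * (r + s) ≡ e + (r + s) * (r + s) + (r + q * (r + s))
staircase-identity = solve-∀

module _ {X Z : List (ℕ × ℕ)} where

  +ˢ-comm : ∀ {x y} → (x , y) ∈ X +ˢ Z → (x , y) ∈ Z +ˢ X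
  +ˢ-comm ((x₁ , y₁) , (x₂ , y₂) , p∈ , q∈ , x≡ , y≡) =
    (x₂ , y₂) , (x₁ , y₁) , q∈ , p∈ , trans (+-comm x₂ x₁) x≡ , trans (+-comm y₂ y₁) y≡

  progression+interval : ∀ e b d c .{{_ : NonZero d}} {y₁ y₂} →
    (∀ k → k < c → (e + k * d , y₁) ∈ X) → (∀ r → r < d → (b + r , y₂) ∈ Z) →
    Covers (λ x → (x , y₁ + y₂) ∈ X +ˢ Z) (e + b) (c * d)
  progression+interval e b d c {y₁} {y₂} X∋ Z∋ = covering sum
    where
    sum : ∀ m → m < c * d → (e + b + m , y₁ + y₂) ∈ X +ˢ Z
    sum m m<cd = (e + q * d , y₁) , (b + r , y₂) , X∋ q (m<n*o⇒m/o<n m<cd) , Z∋ r (m%n<n m d) , x≡ , refl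
      where
      q = m / d
      r = m % d
      x≡ : e + q * d + (b + r) ≡ e + b + m
      x≡ = trans (+-interchange e b r (q * d)) (cong (e + b +_) (sym (m≡m%n+[m/n]*n m d)))

  -- Writing m = q d + r with r < d, the point e + d² + m is (e + r(d+1)) + (d − r + q) d.
  staircase : ∀ e d c .{{_ : NonZero d}} {y₁ y₂} →
    (∀ r → r < d → (e + r * suc d , y₁) ∈ X) → (∀ j → j < d + c → (j * d , y₂) ∈ Z) →
    Covers (λ x → (x , y₁ + y₂) ∈ X +ˢ Z) (e + d * d) (c * d)
  staircase e d c {y₁} {y₂} X∋ Z∋ = covering sum
    where
    sum : ∀ m → m < c * d → (e + d * d + m , y₁ + y₂) ∈ X +ˢ Z
    sum m m<cd = (e + r * suc d , y₁) , ((s + q) * d , y₂) , X∋ r r<d , Z∋ (s + q) s+q<d+c , x≡ , refl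
      where
      q = m / d
      r = m % d
      s = d ∸ r
      r<d : r < d
      r<d = m%n<n m d
      s+q<d+c : s + q < d + c
      s+q<d+c = +-mono-≤-< (m∸n≤m d r) (m<n*o⇒m/o<n m<cd)
      x≡ : e + r * suc d + (s + q) * d ≡ e + d * d + m
      x≡ = begin
        e + r * suc d + (s + q) * d  ≡⟨ subst (λ d′ → e + r * suc d′ + (s + q) * d′ ≡ e + d′ * d′ + (r + q * d′))
                                              (m+[n∸m]≡n (<⇒≤ r<d)) (staircase-identity e r s q) ⟩
        e + d * d + (r + q * d)      ≡⟨ cong (e + d * d +_) (m≡m%n+[m/n]*n m d) ⟨
        e + d * d + m                ∎
        where open ≡-Reasoning

module Properties (sy u : ℕ) where

  t : ℕ
  t = suc u

  open Construction sy t

  at² c₂ c₃ : ℕ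
  at² = a * t * t
  c₂  = 2 * a * t * t
  c₃  = (3 * a + 1) * t * t

  Iᵍ : ℕ → List (ℕ × ℕ)
  Iᵍ b = grid (b +_) (suc t) Y

  Tᵍ Sᵍ Aᵍ : List (ℕ × ℕ)
  Tᵍ = grid (λ k → 0 + k * t) (a * t) (0 ∷ [])
  Sᵍ = grid (λ k → at² + k * suc t) t Y
  Aᵍ = Iᵍ 0 ++ Iᵍ c₂ ++ Iᵍ c₃ ++ Tᵍ ++ Sᵍ

  at≡2+ : a * t ≡ 2 + (4 * sy + 1 + a * u)
  at≡2+ = identity sy u
    where
    identity : ∀ sy u → (4 * sy + 3) * suc u ≡ 2 + (4 * sy + 1 + (4 * sy + 3) * u)
    identity = solve-∀

  at²+t²+[4sy+2]t²≡c₂ : at² + t * t + (4 * sy + 2) * t * t ≡ c₂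
  at²+t²+[4sy+2]t²≡c₂ = identity sy t
    where
    identity : ∀ sy t → (4 * sy + 3) * t * t + t * t + (4 * sy + 2) * t * t ≡ 2 * (4 * sy + 3) * t * t
    identity = solve-∀

  at²+c₂+t²≡c₃ : at² + c₂ + t * t ≡ c₃
  at²+c₂+t²≡c₃ = identity sy t
    where
    identity : ∀ sy t → (4 * sy + 3) * t * t + 2 * (4 * sy + 3) * t * t + t * t ≡ (3 * (4 * sy + 3) + 1) * t * t
    identity = solve-∀

  2+[at∸2]≡at : 2 + (a * t ∸ 2) ≡ a * t
  2+[at∸2]≡at = trans (cong (λ n → 2 + (n ∸ 2)) at≡2+) (sym at≡2+)

  2+j<at : ∀ {j} → j < a * t ∸ 2 → 2 + j < a * t
  2+j<at {j} j< = subst (2 + j <_) 2+[at∸2]≡at (+-monoʳ-< 2 j<)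

  A≡Aᵍ : A ≡ Aᵍ
  A≡Aᵍ = cong₂ _++_ (column≡ 0) (cong₂ _++_ (column≡ c₂) (cong₂ _++_ (column≡ c₃) (cong₂ _++_ T≡Tᵍ S≡Sᵍ)))
    where
    column≡ : ∀ b → [ b , b + t ] ×ˢ Y ≡ Iᵍ b
    column≡ b = trans (cong (_×ˢ Y) (interval≡map b t)) (sym (grid-unfold (b +_) (suc t) Y))
    T≡Tᵍ : T ≡ Tᵍ
    T≡Tᵍ = begin
      AP 0 t (a * t * t ∸ t) ×ˢ (0 ∷ [])
        ≡⟨ cong (_×ˢ (0 ∷ [])) (AP≡map 0 t (a * t ∸ 1) last-of-T) ⟩
      map (λ k → 0 + k * t) (upTo (suc (a * t ∸ 1))) ×ˢ (0 ∷ [])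
        ≡⟨ cong (λ n → map (λ k → 0 + k * t) (upTo n) ×ˢ (0 ∷ [])) (m+[n∸m]≡n 1≤at) ⟩
      map (λ k → 0 + k * t) (upTo (a * t)) ×ˢ (0 ∷ [])
        ≡⟨ grid-unfold (λ k → 0 + k * t) (a * t) (0 ∷ []) ⟨
      Tᵍ ∎
      where
      1≤at : 1 ≤ a * t
      1≤at = subst (1 ≤_) (sym at≡2+) (s≤s z≤n)
      last-of-T : a * t * t ∸ t ≡ 0 + (a * t ∸ 1) * t
      last-of-T = sym (trans (*-distribʳ-∸ t (a * t) 1) (cong (a * t * t ∸_) (*-identityˡ t)))
      open ≡-Reasoning
    S≡Sᵍ : S ≡ Sᵍ
    S≡Sᵍ = trans (cong (_×ˢ Y) (AP≡map at² (suc t) u (cong (_∸ 1) (identity a u))))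
      (sym (grid-unfold (λ k → at² + k * suc t) t Y))
      where
      identity : ∀ a u → (a + 1) * suc u * suc u ≡ suc (a * suc u * suc u + u * suc (suc u))
      identity = solve-∀

  ∈-Y : ∀ {y} → y ≤ sy → y ∈ Y
  ∈-Y y≤sy = ∈-map⁺ (0 +_) (∈-upTo⁺ (s≤s y≤sy))

  unique-Y : Unique Y
  unique-Y = Unique.map⁺ (λ eq → eq) (Unique.upTo⁺ (suc sy))

  I₁⊆Aᵍ : Iᵍ 0 ⊆ Aᵍ
  I₁⊆Aᵍ = ∈-++⁺ˡ

  I₂⊆Aᵍ : Iᵍ c₂ ⊆ Aᵍ
  I₂⊆Aᵍ z∈ = ∈-++⁺ʳ (Iᵍ 0) (∈-++⁺ˡ z∈)

  I₃⊆Aᵍ : Iᵍ c₃ ⊆ Aᵍ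
  I₃⊆Aᵍ z∈ = ∈-++⁺ʳ (Iᵍ 0) (∈-++⁺ʳ (Iᵍ c₂) (∈-++⁺ˡ z∈))

  T⊆Aᵍ : Tᵍ ⊆ Aᵍ
  T⊆Aᵍ z∈ = ∈-++⁺ʳ (Iᵍ 0) (∈-++⁺ʳ (Iᵍ c₂) (∈-++⁺ʳ (Iᵍ c₃) (∈-++⁺ˡ z∈)))

  S⊆Aᵍ : Sᵍ ⊆ Aᵍ
  S⊆Aᵍ z∈ = ∈-++⁺ʳ (Iᵍ 0) (∈-++⁺ʳ (Iᵍ c₂) (∈-++⁺ʳ (Iᵍ c₃) (∈-++⁺ʳ Tᵍ z∈)))

  -- T without (0, 0) and (t, 0), which already lie in I₁.
  T′ : List (ℕ × ℕ)
  T′ = grid (λ k → (2 + k) * t) (a * t ∸ 2) (0 ∷ [])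

  A-distinct : List (ℕ × ℕ)
  A-distinct = Iᵍ 0 ++ T′ ++ Sᵍ ++ Iᵍ c₂ ++ Iᵍ c₃

  A-distinct⊆Aᵍ : A-distinct ⊆ Aᵍ
  A-distinct⊆Aᵍ = ++-⊆ (Iᵍ 0) I₁⊆Aᵍ (++-⊆ T′ (T⊆Aᵍ ∘ T′⊆Tᵍ) (++-⊆ Sᵍ S⊆Aᵍ (++-⊆ (Iᵍ c₂) I₂⊆Aᵍ I₃⊆Aᵍ)))
    where
    T′⊆Tᵍ : T′ ⊆ Tᵍ
    T′⊆Tᵍ z∈ with ∈-grid⁻ (λ k → (2 + k) * t) z∈
    ... | j , _ , j< , here refl , refl = ∈-grid⁺ (λ k → 0 + k * t) (2+j<at j<) (here refl)

  Aᵍ⊆A-distinct : Aᵍ ⊆ A-distinct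
  Aᵍ⊆A-distinct = ++-⊆ (Iᵍ 0) ∈-++⁺ˡ (++-⊆ (Iᵍ c₂) (λ z∈ → after-S (∈-++⁺ˡ z∈))
    (++-⊆ (Iᵍ c₃) (λ z∈ → after-S (∈-++⁺ʳ (Iᵍ c₂) z∈)) (++-⊆ Tᵍ T⊆ (λ z∈ → after-T (∈-++⁺ˡ z∈)))))
    where
    after-T : Sᵍ ++ Iᵍ c₂ ++ Iᵍ c₃ ⊆ A-distinct
    after-T z∈ = ∈-++⁺ʳ (Iᵍ 0) (∈-++⁺ʳ T′ z∈)
    after-S : Iᵍ c₂ ++ Iᵍ c₃ ⊆ A-distinct
    after-S z∈ = after-T (∈-++⁺ʳ Sᵍ z∈)
    T⊆ : Tᵍ ⊆ A-distinct
    T⊆ z∈ with ∈-grid⁻ (λ k → 0 + k * t) z∈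
    ... | 0 , _ , _ , here refl , refl = ∈-++⁺ˡ (∈-grid⁺ (0 +_) {k = 0} (s≤s z≤n) (∈-Y z≤n))
    ... | 1 , _ , _ , here refl , refl =
      ∈-++⁺ˡ (subst (λ x → (x , 0) ∈ Iᵍ 0) (sym (+-identityʳ t)) (∈-grid⁺ (0 +_) {k = t} ≤-refl (∈-Y z≤n)))
    ... | suc (suc j) , _ , 2+j<at , here refl , refl = ∈-++⁺ʳ (Iᵍ 0) (∈-++⁺ˡ (∈-grid⁺ (λ k → (2 + k) * t) j<at∸2 (here refl)))
      where
      j<at∸2 : j < a * t ∸ 2
      j<at∸2 = +-cancelˡ-< 2 j (a * t ∸ 2) (subst (2 + j <_) (sym 2+[at∸2]≡at) 2+j<at)

  1+t≤at² : suc t ≤ at²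
  1+t≤at² = m+n≤o⇒m≤o (suc t) (≤-reflexive (identity sy u))
    where
    identity : ∀ sy u → suc (suc u) + ((4 * sy + 3) * u * u + (8 * sy + 5) * u + (4 * sy + 1)) ≡ (4 * sy + 3) * suc u * suc u
    identity = solve-∀

  at²+t²≤c₂ : at² + t * t ≤ c₂
  at²+t²≤c₂ = m+n≤o⇒m≤o (at² + t * t) (≤-reflexive at²+t²+[4sy+2]t²≡c₂)

  c₂+1+t≤c₃ : c₂ + suc t ≤ c₃
  c₂+1+t≤c₃ = begin
    c₂ + suc t        ≤⟨ +-monoʳ-≤ c₂ 1+t≤at² ⟩
    c₂ + at²          ≡⟨ +-comm c₂ at² ⟩
    at² + c₂          ≤⟨ m≤m+n (at² + c₂) (t * t) ⟩
    at² + c₂ + t * t  ≡⟨ at²+c₂+t²≡c₃ ⟩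
    c₃                ∎
    where open ≤-Reasoning

  unique-column : ∀ b → Unique (Iᵍ b)
  unique-column b = unique-grid (suc t) (+-cancelˡ-≡ b _ _) unique-Y

  column-within : ∀ b {h} → b + suc t ≤ h → Within b h (Iᵍ b)
  column-within b b+1+t≤h = within-grid (λ r<1+t → m≤m+n b _ , <-≤-trans (+-monoʳ-< b r<1+t) b+1+t≤h)

  unique-A-distinct : Unique A-distinct
  unique-A-distinct = proj₁ (
    ++-uniqueAbove z≤n (unique-column 0) (column-within 0 ≤-refl) (
    ++-uniqueAbove 1+t≤at² unique-T′ T′-within (
    ++-uniqueAbove (≤-trans (m≤m+n at² (t * t)) at²+t²≤c₂) unique-S S-within (
    ++-uniqueAbove (≤-trans (m≤m+n c₂ (suc t)) c₂+1+t≤c₃) (unique-column c₂) (column-within c₂ c₂+1+t≤c₃)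
      (unique-column c₃ , proj₁ ∘ column-within c₃ ≤-refl)))))
    where
    unique-T′ : Unique T′
    unique-T′ = unique-grid (a * t ∸ 2) (λ eq → suc-injective (suc-injective (*-cancelʳ-≡ _ _ t eq))) ([] ∷ [])
    T′-within : Within (suc t) at² T′
    T′-within = within-grid λ {j} j< →
      s≤s (≤-trans (m≤m+n t (j * t)) (m≤n+m (t + j * t) u)) , *-monoˡ-< t (2+j<at j<)
    unique-S : Unique Sᵍ
    unique-S = unique-grid t (λ eq → *-cancelʳ-≡ _ _ (suc t) (+-cancelˡ-≡ at² _ _ eq)) unique-Y
    S-within : Within at² c₂ Sᵍ
    S-within = within-grid λ k<t →
      m≤m+n at² _ , <-≤-trans (+-monoʳ-< at² (m<n⇒m*[1+n]<n*n k<t)) at²+t²≤c₂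

  length-A-distinct : length A-distinct ≡ (8 * sy + 7) * t + (3 * sy + 1)
  length-A-distinct = trans
    (length-++-≡ (Iᵍ 0) _ (length-column 0) (length-++-≡ T′ _ length-T′ (length-++-≡ Sᵍ _ length-S
      (length-++-≡ (Iᵍ c₂) (Iᵍ c₃) (length-column c₂) (length-column c₃)))))
    (count sy u)
    where
    length-Y : length Y ≡ suc sy
    length-Y = trans (length-map (0 +_) (upTo (suc sy))) (length-upTo (suc sy))
    length-column : ∀ b → length (Iᵍ b) ≡ suc t * suc sy
    length-column b = trans (length-grid (b +_) (suc t) Y) (cong (suc t *_) length-Y)
    length-T′ : length T′ ≡ (4 * sy + 1 + a * u) * 1
    length-T′ = trans (length-grid _ (a * t ∸ 2) (0 ∷ [])) (cong (λ n → (n ∸ 2) * 1) at≡2+)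
    length-S : length Sᵍ ≡ t * suc sy
    length-S = trans (length-grid _ t Y) (cong (t *_) length-Y)
    count : ∀ sy u →
      suc (suc u) * suc sy + ((4 * sy + 1 + (4 * sy + 3) * u) * 1
        + (suc u * suc sy + (suc (suc u) * suc sy + suc (suc u) * suc sy)))
      ≡ (8 * sy + 7) * suc u + (3 * sy + 1)
    count = solve-∀

  card-A : card A ≡ (8 * sy + 7) * t + (3 * sy + 1)
  card-A = begin
    card A              ≡⟨ cong card A≡Aᵍ ⟩
    card Aᵍ             ≡⟨ card-≡-length unique-A-distinct Aᵍ⊆A-distinct A-distinct⊆Aᵍ ⟩
    length A-distinct   ≡⟨ length-A-distinct ⟩
    (8 * sy + 7) * t + (3 * sy + 1) ∎
    where open ≡-Reasoning

  column-points : ∀ {b} → Iᵍ b ⊆ Aᵍ → ∀ {y} → y ≤ sy → ∀ r → r < suc t → (b + r , y) ∈ Aᵍ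
  column-points I⊆Aᵍ y≤sy r r<1+t = I⊆Aᵍ (∈-grid⁺ _ r<1+t (∈-Y y≤sy))

  T-points : ∀ k → k < a * t → (k * t , 0) ∈ Aᵍ
  T-points k k<at = T⊆Aᵍ (∈-grid⁺ (λ k → 0 + k * t) k<at (here refl))

  S-points : ∀ {y} → y ≤ sy → ∀ k → k < t → (at² + k * suc t , y) ∈ Aᵍ
  S-points y≤sy k k<t = S⊆Aᵍ (∈-grid⁺ (λ k → at² + k * suc t) k<t (∈-Y y≤sy))

  covers-A+A : ∀ {y} → y ≤ sy → Covers (λ x → (x , y) ∈ Aᵍ +ˢ Aᵍ) 0 ((16 * sy + 14) * t * t)
  covers-A+A {y} y≤sy = subst (Covers P 0) (total sy t)
    (covers-++ (sym (+-identityʳ at²)) (column+T I₁⊆Aᵍ)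
    (covers-++ (cong (_+ t * t) (+-identityʳ at²)) (S+column I₁⊆Aᵍ)
    (covers-++ at²+t²+[4sy+2]t²≡c₂ S+T
    (covers-++ (+-comm c₂ at²) (column+T I₂⊆Aᵍ)
    (covers-++ at²+c₂+t²≡c₃ (S+column I₂⊆Aᵍ)
    (covers-++ (+-comm c₃ at²) (column+T I₃⊆Aᵍ) (S+column I₃⊆Aᵍ)))))))
    where
    P : ℕ → Set
    P x = (x , y) ∈ Aᵍ +ˢ Aᵍ
    y+0⇒y : ∀ {x} → (x , y + 0) ∈ Aᵍ +ˢ Aᵍ → P x
    y+0⇒y = subst (λ y′ → (_ , y′) ∈ Aᵍ +ˢ Aᵍ) (+-identityʳ y)
    T-length : ∀ sy t → t + (4 * sy + 2) * t ≡ (4 * sy + 3) * t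
    T-length = solve-∀
    total : ∀ sy t → let at² = (4 * sy + 3) * t * t in
      at² + (t * t + ((4 * sy + 2) * t * t + (at² + (t * t + (at² + t * t))))) ≡ (16 * sy + 14) * t * t
    total = solve-∀
    column+T : ∀ {b} → Iᵍ b ⊆ Aᵍ → Covers P b at²
    column+T {b} I⊆Aᵍ = covers-map +ˢ-comm
      (progression+interval 0 b t (a * t) T-points (λ r r<t → column-points I⊆Aᵍ y≤sy r (m<n⇒m<1+n r<t)))
    S+column : ∀ {b} → Iᵍ b ⊆ Aᵍ → Covers P (at² + b) (t * t)
    S+column {b} I⊆Aᵍ = covers-≤ (*-monoʳ-≤ t (n≤1+n t)) (covers-map y+0⇒y
      (progression+interval at² b (suc t) t (S-points y≤sy) (column-points I⊆Aᵍ z≤n)))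
    S+T : Covers P (at² + t * t) ((4 * sy + 2) * t * t)
    S+T = covers-map y+0⇒y (staircase at² t ((4 * sy + 2) * t) (S-points y≤sy)
      (λ j j< → T-points j (subst (j <_) (T-length sy t) j<)))

theorem7 : (sy t : ℕ) → .{{_ : Data.Nat.NonZero t}} →
    let open Construction sy t in
    card A ≡ (8 * sy + 7) * t + (3 * sy + 1)
    × (∀ x y → x < (16 * sy + 14) * t * t → y ≤ sy → (x , y) ∈ A +ˢ A)
theorem7 sy (suc u) = card-A , λ x y x<N y≤sy →
  subst (λ L → (x , y) ∈ L +ˢ L) (sym A≡Aᵍ) (cover (covers-A+A y≤sy) x x<N)
  where open Properties sy u
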